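{- Let $G$ be a claw-free graph that is not cobipartite, has distinct neighbourhoods, and has diameter $2$. Let $(A,B)$ be an unshatterable proper W-join in $G$. If $G$ admits a disconnected cut, then there exists a disconnected partition $V_1,V_2,V_3,V_4$ of $G$ such that $V_i\cap(A\cup B)=\emptyset$ for some $i\in\{1,2,3,4\}$.
   Context: Graphs are finite, simple, undirected; claw-free means no induced $K_{1,3}$; cobipartite means the complement is bipartite. $N(u)$ is the neighbourhood of $u$. Two adjacent vertices $u,v$ have nested neighbourhoods if $N(u)\setminus\{v\}\subseteq N(v)\setminus\{u\}$ or $N(v)\setminus\{u\}\subseteq N(u)\setminus\{v\}$; $G$ has distinct neighbourhoods if no two vertices have nested neighbourhoods. Disjoint sets $S,T$ are complete if all edges between them are present and anticomplete if none are. A pair $(A,B)$ of disjoint non-empty vertex sets is a W-join if $|A|+|B|>2$, $A$ and $B$ are cliques, $A$ is neither complete nor anticomplete to $B$, and every vertex outside $A\cup B$ is either complete or anticomplete to $A$ and either complete or anticomplete to $B$; it is proper if each vertex of $A$ is neither complete nor anticomplete to $B$ and vice versa. A W-join $(A,B)$ is partitionable if there are partitions of $A$ into non-empty $A',A''$ and of $B$ into non-empty $B',B''$ with $A'$ anticomplete to $B''$ and $B'$ anticomplete to $A''$. A proper W-join is shatterable if it is partitionable with such sets where one of $(A',B')$, $(A'',B'')$ is also a proper W-join, and unshatterable otherwise. For connected $G$, a disconnected cut is a set $U$ with $G-U$ and $G[U]$ both disconnected. A disconnected partition is a partition of $V(G)$ into four non-empty sets $V_1,V_2,V_3,V_4$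 with $V_1$ anticomplete to $V_3$ and $V_2$ anticomplete to $V_4$. -}

module Defs where

open import Data.Nat using (ℕ; _+_; _<_)
open import Data.Fin using (Fin)
open import Data.Fin.Subset using (Subset; _∈_; _∉_; ∣_∣)
open import Data.Bool using (Bool)
open import Data.Product using (Σ; ∃; ∃-syntax; _×_)
open import Data.Sum using (_⊎_)
open import Data.Empty using (⊥)
open import Relation.Nullary using (¬_; Dec)
open import Relation.Binary.PropositionalEquality using (_≡_; _≢_)

record Graph : Set₁ where
  field
    n      : ℕ
    Adj    : Fin n → Fin n → Set
    adj?   : ∀ u v → Dec (Adj u v)
    sym    : ∀ {u v} → Adj u v → Adj v u
    irrefl : ∀ {u} → ¬ Adj u u

module _ (G : Graph) where
  open Graph G

  V : Set
  V = Fin n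

  ClawFree : Set
  ClawFree = ∀ c x y z → x ≢ y → y ≢ z → x ≢ z →
    Adj c x → Adj c y → Adj c z →
    ¬ Adj x y → ¬ Adj y z → ¬ Adj x z → ⊥

  -- complement is bipartite: vertices 2-colourable so that any two
  -- distinct non-adjacent vertices get different colours
  Cobipartite : Set
  Cobipartite = Σ (V → Bool) λ col →
    ∀ u v → u ≢ v → col u ≡ col v → Adj u v

  NbhdIncl : V → V → Set
  NbhdIncl u v = ∀ w → w ≢ v → Adj u w → w ≢ u × Adj v w

  NestedNbhds : V → V → Set
  NestedNbhds u v = Adj u v × (NbhdIncl u v ⊎ NbhdIncl v u)

  DistinctNbhds : Set
  DistinctNbhds = ∀ u v → ¬ NestedNbhds u v

  Dist≤2 : V → V → Set
  Dist≤2 u v = u ≡ v ⊎ Adj u v ⊎ (∃[ w ] (Adj u w × Adj w v))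

  Diameter2 : Set
  Diameter2 = (∀ u v → Dist≤2 u v) × (∃[ u ] ∃[ v ] (u ≢ v × ¬ Adj u v))

  NonEmpty : Subset n → Set
  NonEmpty S = ∃[ x ] (x ∈ S)

  Disjoint : Subset n → Subset n → Set
  Disjoint S T = ∀ x → x ∈ S → x ∈ T → ⊥

  Clique : Subset n → Set
  Clique S = ∀ x y → x ∈ S → y ∈ S → x ≢ y → Adj x y

  Complete : Subset n → Subset n → Set
  Complete S T = ∀ x y → x ∈ S → y ∈ T → Adj x y

  Anticomplete : Subset n → Subset n → Set
  Anticomplete S T = ∀ x y → x ∈ S → y ∈ T → ¬ Adj x y

  VComplete : V → Subset n → Set
  VComplete x S = ∀ y → y ∈ S → Adj x y

  VAnticomplete : V → Subset n → Set
  VAnticomplete x S = ∀ y → y ∈ S → ¬ Adj x y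

  Partition2 : Subset n → Subset n → Subset n → Set
  Partition2 S S₁ S₂ = NonEmpty S₁ × NonEmpty S₂ × Disjoint S₁ S₂ ×
    (∀ x → x ∈ S → x ∈ S₁ ⊎ x ∈ S₂) ×
    (∀ x → x ∈ S₁ → x ∈ S) × (∀ x → x ∈ S₂ → x ∈ S)

  WJoin : Subset n → Subset n → Set
  WJoin A B = Disjoint A B × NonEmpty A × NonEmpty B ×
    2 < ∣ A ∣ + ∣ B ∣ × Clique A × Clique B ×
    ¬ Complete A B × ¬ Anticomplete A B ×
    (∀ x → x ∉ A → x ∉ B →
       (VComplete x A ⊎ VAnticomplete x A) × (VComplete x B ⊎ VAnticomplete x B))

  ProperWJoin : Subset n → Subset n → Set
  ProperWJoin A B = WJoin A B ×
    (∀ a → a ∈ A → ¬ VComplete a B × ¬ VAnticomplete a B) ×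
    (∀ b → b ∈ B → ¬ VComplete b A × ¬ VAnticomplete b A)

  PartitionSets : Subset n → Subset n →
    Subset n → Subset n → Subset n → Subset n → Set
  PartitionSets A B A′ A″ B′ B″ = Partition2 A A′ A″ × Partition2 B B′ B″ ×
    Anticomplete A′ B″ × Anticomplete B′ A″

  Partitionable : Subset n → Subset n → Set
  Partitionable A B = ∃[ A′ ] ∃[ A″ ] ∃[ B′ ] ∃[ B″ ] PartitionSets A B A′ A″ B′ B″

  Shatterable : Subset n → Subset n → Set
  Shatterable A B = ProperWJoin A B ×
    (∃[ A′ ] ∃[ A″ ] ∃[ B′ ] ∃[ B″ ] (PartitionSets A B A′ A″ B′ B″ ×
       (ProperWJoin A′ B′ ⊎ ProperWJoin A″ B″)))

  Unshatterable : Subset n → Subset n → Set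
  Unshatterable A B = ProperWJoin A B × ¬ Shatterable A B

  InducedDisconnected : Subset n → Set
  InducedDisconnected S = ∃[ X ] ∃[ Y ] (Partition2 S X Y × Anticomplete X Y)

  DisconnectedCut : Subset n → Set
  DisconnectedCut U = InducedDisconnected U ×
    (∃[ W ] ((∀ x → x ∈ W ⊎ x ∈ U) × Disjoint W U × InducedDisconnected W))

  DisconnectedPartition : Subset n → Subset n → Subset n → Subset n → Set
  DisconnectedPartition V₁ V₂ V₃ V₄ =
    NonEmpty V₁ × NonEmpty V₂ × NonEmpty V₃ × NonEmpty V₄ ×
    (∀ x → x ∈ V₁ ⊎ x ∈ V₂ ⊎ x ∈ V₃ ⊎ x ∈ V₄) ×
    Disjoint V₁ V₂ × Disjoint V₁ V₃ × Disjoint V₁ V₄ ×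
    Disjoint V₂ V₃ × Disjoint V₂ V₄ × Disjoint V₃ V₄ ×
    Anticomplete V₁ V₃ × Anticomplete V₂ V₄

  AvoidsBoth : Subset n → Subset n → Subset n → Set
  AvoidsBoth S A B = Disjoint S A × Disjoint S B

-- A disconnected partition V₁,V₂,V₃,V₄ is encoded as a labelling of the vertices
-- by four classes c₁,c₂,c₃,c₄ in which opposite classes (c₁/c₃ and c₂/c₄) are
-- anticomplete and every class is non-empty.  A disconnected cut U = X ∪ Y with
-- complement P ∪ Q gives such a labelling (X, P, Y, Q).  If some class misses
-- A ∪ B we are done.  Otherwise, since A and B are cliques, A meets two
-- consecutive classes and B the other two; after a symmetry of the 4-cycle of
-- classes, A meets c₁, c₂ and B meets c₃, c₄ (the labelling "straddles" the
-- W-join).  Then A ⊆ c₁ ∪ c₂ and B ⊆ c₃ ∪ c₄.  If c₁ has a vertex outside A and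
-- c₄ one outside B, moving all of A into c₂ and all of B into c₃ keeps the
-- labelling disconnected and empties c₁ of A ∪ B; symmetrically for c₂, c₃.
-- In the remaining "tight" case, claw-freeness and diameter at most 2 force
-- c₁ ∪ c₂ and c₃ ∪ c₄ to be cliques, so G would be cobipartite.
module Submission where

open import Defs
open import Data.Bool using (Bool; true; false)
open import Data.Empty using (⊥; ⊥-elim)
open import Data.Fin using (Fin; zero; suc; _≟_)
open import Data.Fin.Properties using (any?)
open import Data.Fin.Subset using (Subset; _∈_; _∉_)
open import Data.Fin.Subset.Properties using (_∈?_)
open import Data.Product using (Σ; ∃-syntax; _×_; _,_; proj₁; proj₂) renaming (swap to ×-swap)
open import Data.Sum using (_⊎_; inj₁; inj₂) renaming (swap to ⊎-swap)
open import Data.Vec using (tabulate)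
open import Data.Vec.Properties using ([]=⇒lookup; lookup⇒[]=; lookup∘tabulate)
open import Function using (_∘_)
open import Relation.Nullary using (¬_; yes; no; does; ¬?)
open import Relation.Nullary.Decidable using (dec-true; decidable-stable; _×-dec_; _⊎-dec_)
open import Relation.Binary.PropositionalEquality
  using (_≡_; _≢_; refl; sym; trans; cong; subst)

Class : Set
Class = Fin 4

pattern c₁ = zero
pattern c₂ = suc zero
pattern c₃ = suc (suc zero)
pattern c₄ = suc (suc (suc zero))

opp : Class → Class
opp c₁ = c₃
opp c₂ = c₄
opp c₃ = c₁
opp c₄ = c₂

opp-involutive : ∀ c → opp (opp c) ≡ c
opp-involutive c₁ = refl
opp-involutive c₂ = refl
opp-involutive c₃ = refl
opp-involutive c₄ = refl

opp-swap : ∀ {c d} → c ≡ opp d → d ≡ opp c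
opp-swap {d = d} e = trans (sym (opp-involutive d)) (cong opp (sym e))

opp-distinct : ∀ c → c ≢ opp c
opp-distinct c₁ ()
opp-distinct c₂ ()
opp-distinct c₃ ()
opp-distinct c₄ ()

-- A permutation of the classes respecting oppositeness; relabelling by it
-- preserves every property of a labelling we consider.
record Symmetry : Set where
  field
    act          : Class → Class
    inverse      : Class → Class
    left-inverse : ∀ c → inverse (act c) ≡ c
    commutes     : ∀ c → act (opp c) ≡ opp (act c)

  injective : ∀ {c d} → act c ≡ act d → c ≡ d
  injective {c} {d} e = trans (sym (left-inverse c)) (trans (cong inverse e) (left-inverse d))

open Symmetry using (act)

flip-act : Class → Class
flip-act c₁ = c₂
flip-act c₂ = c₁
flip-act c₃ = c₄
flip-act c₄ = c₃

flip : Symmetry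
flip = record
  { act = flip-act ; inverse = flip-act
  ; left-inverse = λ { c₁ → refl ; c₂ → refl ; c₃ → refl ; c₄ → refl }
  ; commutes     = λ { c₁ → refl ; c₂ → refl ; c₃ → refl ; c₄ → refl } }

reflect-act : Class → Class
reflect-act c₁ = c₄
reflect-act c₂ = c₃
reflect-act c₃ = c₂
reflect-act c₄ = c₁

reflect : Symmetry
reflect = record
  { act = reflect-act ; inverse = reflect-act
  ; left-inverse = λ { c₁ → refl ; c₂ → refl ; c₃ → refl ; c₄ → refl }
  ; commutes     = λ { c₁ → refl ; c₂ → refl ; c₃ → refl ; c₄ → refl } }

rotate-act unrotate-act : Class → Class
rotate-act c₁ = c₄
rotate-act c₂ = c₁
rotate-act c₃ = c₂
rotate-act c₄ = c₃
unrotate-act c₁ = c₂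
unrotate-act c₂ = c₃
unrotate-act c₃ = c₄
unrotate-act c₄ = c₁

rotate : Symmetry
rotate = record
  { act = rotate-act ; inverse = unrotate-act
  ; left-inverse = λ { c₁ → refl ; c₂ → refl ; c₃ → refl ; c₄ → refl }
  ; commutes     = λ { c₁ → refl ; c₂ → refl ; c₃ → refl ; c₄ → refl } }

-- The left classes c₁, c₂ and the right classes c₃, c₄; in the cobipartite
-- case they are the two colour classes.
data Left : Class → Set where
  c₁-left : Left c₁
  c₂-left : Left c₂

data Right : Class → Set where
  c₃-right : Right c₃
  c₄-right : Right c₄

side : ∀ c → Left c ⊎ Right c
side c₁ = inj₁ c₁-left
side c₂ = inj₁ c₂-left
side c₃ = inj₂ c₃-right
side c₄ = inj₂ c₄-right

isLeft : Class → Bool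
isLeft c₁ = true
isLeft c₂ = true
isLeft c₃ = false
isLeft c₄ = false

sides-differ : ∀ {c d} → Left c → Right d → isLeft c ≢ isLeft d
sides-differ c₁-left c₃-right ()
sides-differ c₁-left c₄-right ()
sides-differ c₂-left c₃-right ()
sides-differ c₂-left c₄-right ()

opp-left : ∀ {c} → Left c → Right (opp c)
opp-left c₁-left = c₃-right
opp-left c₂-left = c₄-right

opp-right : ∀ {c} → Right c → Left (opp c)
opp-right c₃-right = c₁-left
opp-right c₄-right = c₂-left

reflect-right : ∀ {c} → Right c → Left (act reflect c)
reflect-right c₃-right = c₂-left
reflect-right c₄-right = c₁-left

module _ (G : Graph) where
  open Graph G renaming (sym to adj-sym)

  Separated : (V G → Class) → Set
  Separated f = ∀ x y → f y ≡ opp (f x) → ¬ Adj x y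

  apart : ∀ {f x y c} → Separated f → f x ≡ c → f y ≡ opp c → ¬ Adj x y
  apart {x = x} {y} sep fx fy = sep x y (trans fy (cong opp (sym fx)))

  relabel : ∀ {f} (σ : Symmetry) → Separated f → Separated (act σ ∘ f)
  relabel σ sep x y e = sep x y (injective (trans e (sym (commutes _))))
    where open Symmetry σ

  record DisconnectedLabelling (f : V G → Class) : Set where
    field
      separated : Separated f
      onto      : ∀ c → ∃[ x ] (f x ≡ c)

  classSet : (V G → Class) → Class → Subset n
  classSet f c = tabulate (λ x → does (f x ≟ c))

  ∈-classSet : ∀ f {x c} → f x ≡ c → x ∈ classSet f c
  ∈-classSet f {x} {c} fx =
    lookup⇒[]= x _ (trans (lookup∘tabulate (λ y → does (f y ≟ c)) x) (dec-true (f x ≟ c) fx))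

  classSet-∈ : ∀ f {x c} → x ∈ classSet f c → f x ≡ c
  classSet-∈ f {x} {c} x∈
    with f x ≟ c | trans (sym (lookup∘tabulate (λ y → does (f y ≟ c)) x)) ([]=⇒lookup x∈)
  ... | yes fx | _ = fx
  ... | no _   | ()

  classes-partition : ∀ {f} → DisconnectedLabelling f →
    DisconnectedPartition G (classSet f c₁) (classSet f c₂) (classSet f c₃) (classSet f c₄)
  classes-partition {f} L =
    nonempty c₁ , nonempty c₂ , nonempty c₃ , nonempty c₄ , (λ x → cover x refl) ,
    disjoint (λ ()) , disjoint (λ ()) , disjoint (λ ()) ,
    disjoint (λ ()) , disjoint (λ ()) , disjoint (λ ()) ,
    anticomplete c₁ , anticomplete c₂
    where
    open DisconnectedLabelling L
    nonempty : ∀ c → NonEmpty G (classSet f c)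
    nonempty c = proj₁ (onto c) , ∈-classSet f (proj₂ (onto c))
    disjoint : ∀ {c d} → c ≢ d → Disjoint G (classSet f c) (classSet f d)
    disjoint c≢d x x∈c x∈d = c≢d (trans (sym (classSet-∈ f x∈c)) (classSet-∈ f x∈d))
    anticomplete : ∀ c → Anticomplete G (classSet f c) (classSet f (opp c))
    anticomplete c x y x∈ y∈ = apart separated (classSet-∈ f x∈) (classSet-∈ f y∈)
    cover : ∀ x {c} → f x ≡ c →
      x ∈ classSet f c₁ ⊎ x ∈ classSet f c₂ ⊎ x ∈ classSet f c₃ ⊎ x ∈ classSet f c₄
    cover x {c₁} fx = inj₁ (∈-classSet f fx)
    cover x {c₂} fx = inj₂ (inj₁ (∈-classSet f fx))
    cover x {c₃} fx = inj₂ (inj₂ (inj₁ (∈-classSet f fx)))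
    cover x {c₄} fx = inj₂ (inj₂ (inj₂ (∈-classSet f fx)))

  cutLabelling : ∀ {U} → DisconnectedCut G U → ∃[ f ] DisconnectedLabelling f
  cutLabelling ((X , Y , (neX , neY , X∩Y , U⊆X∪Y , X⊆U , Y⊆U) , X-Y) ,
                (W , V⊆W∪U , W∩U , (P , Q , (neP , neQ , P∩Q , W⊆P∪Q , P⊆W , Q⊆W) , P-Q))) =
    f , record { separated = separated ; onto = onto }
    where
    part : Class → Subset n
    part c₁ = X
    part c₂ = P
    part c₃ = Y
    part c₄ = Q
    classify : ∀ x → Σ Class (λ c → x ∈ part c)
    classify x with V⊆W∪U x
    ... | inj₁ x∈W with W⊆P∪Q x x∈W
    ...   | inj₁ x∈P = c₂ , x∈P
    ...   | inj₂ x∈Q = c₄ , x∈Q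
    classify x | inj₂ x∈U with U⊆X∪Y x x∈U
    ...   | inj₁ x∈X = c₁ , x∈X
    ...   | inj₂ x∈Y = c₃ , x∈Y
    f : V G → Class
    f x = proj₁ (classify x)
    in-part : ∀ x → x ∈ part (f x)
    in-part x = proj₂ (classify x)
    unique : ∀ {x} c d → x ∈ part c → x ∈ part d → c ≡ d
    unique c₁ c₁ _ _ = refl
    unique c₂ c₂ _ _ = refl
    unique c₃ c₃ _ _ = refl
    unique c₄ c₄ _ _ = refl
    unique c₁ c₃ x∈X x∈Y = ⊥-elim (X∩Y _ x∈X x∈Y)
    unique c₃ c₁ x∈Y x∈X = ⊥-elim (X∩Y _ x∈X x∈Y)
    unique c₂ c₄ x∈P x∈Q = ⊥-elim (P∩Q _ x∈P x∈Q)
    unique c₄ c₂ x∈Q x∈P = ⊥-elim (P∩Q _ x∈P x∈Q)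
    unique c₁ c₂ x∈X x∈P = ⊥-elim (W∩U _ (P⊆W _ x∈P) (X⊆U _ x∈X))
    unique c₁ c₄ x∈X x∈Q = ⊥-elim (W∩U _ (Q⊆W _ x∈Q) (X⊆U _ x∈X))
    unique c₃ c₂ x∈Y x∈P = ⊥-elim (W∩U _ (P⊆W _ x∈P) (Y⊆U _ x∈Y))
    unique c₃ c₄ x∈Y x∈Q = ⊥-elim (W∩U _ (Q⊆W _ x∈Q) (Y⊆U _ x∈Y))
    unique c₂ c₁ x∈P x∈X = ⊥-elim (W∩U _ (P⊆W _ x∈P) (X⊆U _ x∈X))
    unique c₄ c₁ x∈Q x∈X = ⊥-elim (W∩U _ (Q⊆W _ x∈Q) (X⊆U _ x∈X))
    unique c₂ c₃ x∈P x∈Y = ⊥-elim (W∩U _ (P⊆W _ x∈P) (Y⊆U _ x∈Y))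
    unique c₄ c₃ x∈Q x∈Y = ⊥-elim (W∩U _ (Q⊆W _ x∈Q) (Y⊆U _ x∈Y))
    opposite-anticomplete : ∀ c → Anticomplete G (part c) (part (opp c))
    opposite-anticomplete c₁ = X-Y
    opposite-anticomplete c₂ = P-Q
    opposite-anticomplete c₃ x y x∈Y y∈X xy = X-Y y x y∈X x∈Y (adj-sym xy)
    opposite-anticomplete c₄ x y x∈Q y∈P xy = P-Q y x y∈P x∈Q (adj-sym xy)
    separated : Separated f
    separated x y fy =
      opposite-anticomplete (f x) x y (in-part x) (subst (λ c → y ∈ part c) fy (in-part y))
    nonempty : ∀ c → NonEmpty G (part c)
    nonempty c₁ = neX
    nonempty c₂ = neP
    nonempty c₃ = neY
    nonempty c₄ = neQ
    onto : ∀ c → ∃[ x ] (f x ≡ c)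
    onto c = proj₁ (nonempty c) , unique (f _) c (in-part _) (proj₂ (nonempty c))

  Avoids : Subset n → Subset n → (V G → Class) → Class → Set
  Avoids A B f c = ∀ x → f x ≡ c → x ∉ A × x ∉ B

  AvoidingLabelling : Subset n → Subset n → Set
  AvoidingLabelling A B = ∃[ f ] (DisconnectedLabelling f × ∃[ c ] Avoids A B f c)

  Conclusion : Subset n → Subset n → Set
  Conclusion A B =
    ∃[ V₁ ] ∃[ V₂ ] ∃[ V₃ ] ∃[ V₄ ] (DisconnectedPartition G V₁ V₂ V₃ V₄ ×
    (AvoidsBoth G V₁ A B ⊎ AvoidsBoth G V₂ A B ⊎ AvoidsBoth G V₃ A B ⊎ AvoidsBoth G V₄ A B))

  conclusion : ∀ {A B} → AvoidingLabelling A B → Conclusion A B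
  conclusion {A} {B} (f , L , c , avoids) =
    classSet f c₁ , classSet f c₂ , classSet f c₃ , classSet f c₄ ,
    classes-partition L , pick c avoids
    where
    avoidsBoth : ∀ c → Avoids A B f c → AvoidsBoth G (classSet f c) A B
    avoidsBoth c av = (λ x x∈ → proj₁ (av x (classSet-∈ f x∈))) ,
                      (λ x x∈ → proj₂ (av x (classSet-∈ f x∈)))
    pick : ∀ c → Avoids A B f c →
      AvoidsBoth G (classSet f c₁) A B ⊎ AvoidsBoth G (classSet f c₂) A B ⊎
      AvoidsBoth G (classSet f c₃) A B ⊎ AvoidsBoth G (classSet f c₄) A B
    pick c₁ av = inj₁ (avoidsBoth c₁ av)
    pick c₂ av = inj₂ (inj₁ (avoidsBoth c₂ av))
    pick c₃ av = inj₂ (inj₂ (inj₁ (avoidsBoth c₃ av)))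
    pick c₄ av = inj₂ (inj₂ (inj₂ (avoidsBoth c₄ av)))

  record Join (A B : Subset n) : Set where
    field
      disjoint    : Disjoint G A B
      cliqueA     : Clique G A
      cliqueB     : Clique G B
      homogeneous : ∀ x → x ∉ A → x ∉ B →
        (VComplete G x A ⊎ VAnticomplete G x A) × (VComplete G x B ⊎ VAnticomplete G x B)
      neighbourA  : ∀ a → a ∈ A → ∃[ b ] (b ∈ B × Adj a b)
      neighbourB  : ∀ b → b ∈ B → ∃[ a ] (a ∈ A × Adj b a)

  neighbour-in : ∀ {x S} → ¬ VAnticomplete G x S → ∃[ y ] (y ∈ S × Adj x y)
  neighbour-in {x} {S} ¬anti with any? (λ y → (y ∈? S) ×-dec adj? x y)
  ... | yes found = found
  ... | no none = ⊥-elim (¬anti (λ y y∈S xy → none (y , y∈S , xy)))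

  properJoin : ∀ {A B} → ProperWJoin G A B → Join A B
  properJoin ((disjoint , _ , _ , _ , cliqueA , cliqueB , _ , _ , homogeneous) , properA , properB) =
    record { disjoint = disjoint ; cliqueA = cliqueA ; cliqueB = cliqueB
           ; homogeneous = homogeneous
           ; neighbourA = λ a a∈A → neighbour-in (proj₂ (properA a a∈A))
           ; neighbourB = λ b b∈B → neighbour-in (proj₂ (properB b b∈B)) }

  swapJoin : ∀ {A B} → Join A B → Join B A
  swapJoin J = record
    { disjoint = λ x x∈B x∈A → disjoint x x∈A x∈B ; cliqueA = cliqueB ; cliqueB = cliqueA
    ; homogeneous = λ x x∉B x∉A → ×-swap (homogeneous x x∉A x∉B)
    ; neighbourA = neighbourB ; neighbourB = neighbourA }
    where open Join J

  nonneighbour-A : ∀ {A B x a} → Join A B → x ∉ A → x ∉ B → a ∈ A → ¬ Adj x a →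
    VAnticomplete G x A
  nonneighbour-A J x∉A x∉B a∈A ¬xa with proj₁ (Join.homogeneous J _ x∉A x∉B)
  ... | inj₁ complete     = ⊥-elim (¬xa (complete _ a∈A))
  ... | inj₂ anticomplete = anticomplete

  nonneighbour-B : ∀ {A B x b} → Join A B → x ∉ A → x ∉ B → b ∈ B → ¬ Adj x b →
    VAnticomplete G x B
  nonneighbour-B J x∉A x∉B = nonneighbour-A (swapJoin J) x∉B x∉A

  data Place (A B : Subset n) (x : V G) : Set where
    inA     : x ∈ A → Place A B x
    inB     : x ∈ B → Place A B x
    outside : x ∉ A → x ∉ B → Place A B x

  place : ∀ A B x → Place A B x
  place A B x with x ∈? A | x ∈? B
  ... | yes x∈A | _       = inA x∈A
  ... | no _    | yes x∈B = inB x∈B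
  ... | no x∉A  | no x∉B  = outside x∉A x∉B

  Meets : Subset n → (V G → Class) → Class → Set
  Meets S f c = ∃[ x ] (x ∈ S × f x ≡ c)

  Covers : Subset n → (V G → Class) → Class → Set
  Covers S f c = ∀ x → f x ≡ c → x ∈ S

  Escapes : Subset n → (V G → Class) → Class → Set
  Escapes S f c = ∃[ x ] (f x ≡ c × x ∉ S)

  meets-relabel : ∀ {S f c} (σ : Symmetry) → Meets S f c → Meets S (act σ ∘ f) (act σ c)
  meets-relabel σ (x , x∈S , fx) = x , x∈S , cong (act σ) fx

  escapes-relabel : ∀ {S f c} (σ : Symmetry) → Escapes S f c → Escapes S (act σ ∘ f) (act σ c)
  escapes-relabel σ (x , fx , x∉S) = x , cong (act σ) fx , x∉S

  covers-relabel : ∀ {S f c} (σ : Symmetry) → Covers S f c → Covers S (act σ ∘ f) (act σ c)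
  covers-relabel σ covers x e = covers x (Symmetry.injective σ e)

  covers-or-escapes : ∀ S f c → Covers S f c ⊎ Escapes S f c
  covers-or-escapes S f c with any? (λ x → (f x ≟ c) ×-dec ¬? (x ∈? S))
  ... | yes escape = inj₂ escape
  ... | no none = inj₁ (λ x fx → decidable-stable (x ∈? S) (λ x∉S → none (x , fx , x∉S)))

  escapes-or-covers : ∀ A B f c d →
    (Escapes A f c × Escapes B f d) ⊎ (Covers A f c ⊎ Covers B f d)
  escapes-or-covers A B f c d with covers-or-escapes A f c | covers-or-escapes B f d
  ... | inj₁ k | _      = inj₂ (inj₁ k)
  ... | inj₂ _ | inj₁ k = inj₂ (inj₂ k)
  ... | inj₂ e | inj₂ e′ = inj₁ (e , e′)

  avoids-or-meets : ∀ A B f c → Avoids A B f c ⊎ (Meets A f c ⊎ Meets B f c)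
  avoids-or-meets A B f c with any? (λ x → (f x ≟ c) ×-dec ((x ∈? A) ⊎-dec (x ∈? B)))
  ... | yes (x , fx , inj₁ x∈A) = inj₂ (inj₁ (x , x∈A , fx))
  ... | yes (x , fx , inj₂ x∈B) = inj₂ (inj₂ (x , x∈B , fx))
  ... | no none =
    inj₁ (λ x fx → (λ x∈A → none (x , fx , inj₁ x∈A)) , (λ x∈B → none (x , fx , inj₂ x∈B)))

  clique-opposite : ∀ {S f c} → Clique G S → Separated f → Meets S f c → Meets S f (opp c) → ⊥
  clique-opposite {c = c} clique sep (x , x∈S , fx) (y , y∈S , fy) =
    apart sep fx fy (clique x y x∈S y∈S (λ { refl → opp-distinct c (trans (sym fx) fy) }))

  Straddle : Subset n → Subset n → (V G → Class) → Set
  Straddle A B f = Meets A f c₁ × Meets A f c₂ × Meets B f c₃ × Meets B f c₄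

  flip-straddle : ∀ {A B f} → Straddle A B f → Straddle A B (act flip ∘ f)
  flip-straddle (M₁ , M₂ , M₃ , M₄) =
    meets-relabel flip M₂ , meets-relabel flip M₁ , meets-relabel flip M₄ , meets-relabel flip M₃

  reflect-straddle : ∀ {A B f} → Straddle A B f → Straddle B A (act reflect ∘ f)
  reflect-straddle (M₁ , M₂ , M₃ , M₄) =
    meets-relabel reflect M₄ , meets-relabel reflect M₃ ,
    meets-relabel reflect M₂ , meets-relabel reflect M₁

  Tight : Subset n → Subset n → (V G → Class) → Set
  Tight A B f = (Covers A f c₁ ⊎ Covers B f c₄) × (Covers A f c₂ ⊎ Covers B f c₃)

  module Straddled {A B f} (J : Join A B) (sep : Separated f) (S : Straddle A B f) where
    open Join J

    A-in : ∀ {c} → Left c → Meets A f c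
    A-in c₁-left = proj₁ S
    A-in c₂-left = proj₁ (proj₂ S)

    B-in : ∀ {c} → Right c → Meets B f c
    B-in c₃-right = proj₁ (proj₂ (proj₂ S))
    B-in c₄-right = proj₂ (proj₂ (proj₂ S))

    A-not-right : ∀ {x c} → x ∈ A → f x ≡ c → Right c → ⊥
    A-not-right {x} {c} x∈A fx r =
      clique-opposite cliqueA sep (A-in (opp-right r)) (x , x∈A , trans fx (sym (opp-involutive c)))

    B-not-left : ∀ {x c} → x ∈ B → f x ≡ c → Left c → ⊥
    B-not-left {x} {c} x∈B fx l =
      clique-opposite cliqueB sep (B-in (opp-left l)) (x , x∈B , trans fx (sym (opp-involutive c)))

    -- an outside vertex in a left class misses the vertex of B in the
    -- opposite class, hence is anticomplete to B; dually on the right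
    left-anticomplete-B : ∀ {x c} → x ∉ A → x ∉ B → f x ≡ c → Left c → VAnticomplete G x B
    left-anticomplete-B x∉A x∉B fx l with B-in (opp-left l)
    ... | b , b∈B , fb = nonneighbour-B J x∉A x∉B b∈B (apart sep fx fb)

    right-anticomplete-A : ∀ {x c} → x ∉ A → x ∉ B → f x ≡ c → Right c → VAnticomplete G x A
    right-anticomplete-A x∉A x∉B fx r with A-in (opp-right r)
    ... | a , a∈A , fa = nonneighbour-A J x∉A x∉B a∈A (apart sep fx fa)

    moved : ∀ {x} → Place A B x → Class → Class
    moved (inA _)       _ = c₂
    moved (inB _)       _ = c₃
    moved (outside _ _) c = c

    relocated : V G → Class
    relocated x = moved (place A B x) (f x)

    -- a moved vertex of A (in c₂) and an outside vertex in c₄ are non-adjacent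
    -- by the right-anticompleteness above; similarly for B, c₃ and c₁
    moved-separated : ∀ {x y} (p : Place A B x) (q : Place A B y) →
      moved q (f y) ≡ opp (moved p (f x)) → ¬ Adj x y
    moved-separated (inA _) (inA _) ()
    moved-separated (inA _) (inB _) ()
    moved-separated (inA x∈A) (outside y∉A y∉B) fy xy =
      right-anticomplete-A y∉A y∉B fy c₄-right _ x∈A (adj-sym xy)
    moved-separated (inB _) (inA _) ()
    moved-separated (inB _) (inB _) ()
    moved-separated (inB x∈B) (outside y∉A y∉B) fy xy =
      left-anticomplete-B y∉A y∉B fy c₁-left _ x∈B (adj-sym xy)
    moved-separated (outside x∉A x∉B) (inA y∈A) e =
      right-anticomplete-A x∉A x∉B (opp-swap e) c₄-right _ y∈A
    moved-separated (outside x∉A x∉B) (inB y∈B) e =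
      left-anticomplete-B x∉A x∉B (opp-swap e) c₁-left _ y∈B
    moved-separated (outside _ _) (outside _ _) e = sep _ _ e

    moved-A : ∀ {x} (p : Place A B x) → x ∈ A → moved p (f x) ≡ c₂
    moved-A (inA _)           _   = refl
    moved-A (inB x∈B)         x∈A = ⊥-elim (disjoint _ x∈A x∈B)
    moved-A (outside x∉A _)   x∈A = ⊥-elim (x∉A x∈A)

    moved-B : ∀ {x} (p : Place A B x) → x ∈ B → moved p (f x) ≡ c₃
    moved-B (inA x∈A)         x∈B = ⊥-elim (disjoint _ x∈A x∈B)
    moved-B (inB _)           _   = refl
    moved-B (outside _ x∉B)   x∈B = ⊥-elim (x∉B x∈B)

    moved-outside : ∀ {x} (p : Place A B x) → x ∉ A → x ∉ B → moved p (f x) ≡ f x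
    moved-outside (inA x∈A)     x∉A _   = ⊥-elim (x∉A x∈A)
    moved-outside (inB x∈B)     _   x∉B = ⊥-elim (x∉B x∈B)
    moved-outside (outside _ _) _   _   = refl

    moved-c₁ : ∀ {x} (p : Place A B x) → moved p (f x) ≡ c₁ → x ∉ A × x ∉ B
    moved-c₁ (inA _) ()
    moved-c₁ (inB _) ()
    moved-c₁ (outside x∉A x∉B) _ = x∉A , x∉B

    relocate : Escapes A f c₁ → Escapes B f c₄ → AvoidingLabelling A B
    relocate (w₁ , fw₁ , w₁∉A) (w₄ , fw₄ , w₄∉B) =
      relocated ,
      record { separated = λ x y → moved-separated (place A B x) (place A B y) ; onto = onto } ,
      c₁ , (λ x → moved-c₁ (place A B x))
      where
      onto : ∀ c → ∃[ x ] (relocated x ≡ c)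
      onto c₁ = w₁ , trans (moved-outside (place A B w₁) w₁∉A w₁∉B) fw₁
        where
        w₁∉B : w₁ ∉ B
        w₁∉B w₁∈B = B-not-left w₁∈B fw₁ c₁-left
      onto c₂ with A-in c₂-left
      ... | a , a∈A , _ = a , moved-A (place A B a) a∈A
      onto c₃ with B-in c₃-right
      ... | b , b∈B , _ = b , moved-B (place A B b) b∈B
      onto c₄ = w₄ , trans (moved-outside (place A B w₄) w₄∉A w₄∉B) fw₄
        where
        w₄∉A : w₄ ∉ A
        w₄∉A w₄∈A = A-not-right w₄∈A fw₄ c₄-right

    module _ (claw-free : ClawFree G) (close : ∀ u v → Dist≤2 G u v) (T : Tight A B f) where

      -- an edge between an outside vertex of a left class and a vertex
      -- outside B in a right class is excluded by separation or tightness
      no-crossing : ∀ {x w c d} → x ∉ A → w ∉ B → f x ≡ c → f w ≡ d →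
        Left c → Right d → ¬ Adj x w
      no-crossing x∉A w∉B fx fw c₁-left r xw with proj₁ T | r
      ... | inj₁ c₁⊆A | _        = x∉A (c₁⊆A _ fx)
      ... | inj₂ _    | c₃-right = apart sep fx fw xw
      ... | inj₂ c₄⊆B | c₄-right = w∉B (c₄⊆B _ fw)
      no-crossing x∉A w∉B fx fw c₂-left r xw with proj₂ T | r
      ... | inj₁ c₂⊆A | _        = x∉A (c₂⊆A _ fx)
      ... | inj₂ c₃⊆B | c₃-right = w∉B (c₃⊆B _ fw)
      ... | inj₂ _    | c₄-right = apart sep fx fw xw

      -- an outside vertex x of a left class is complete to A: otherwise it is
      -- anticomplete to A and to B, and no path x – w – b of length ≤ 2 reaches b ∈ B
      left-complete-A : ∀ {x c} → x ∉ A → x ∉ B → f x ≡ c → Left c → VComplete G x A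
      left-complete-A {x} x∉A x∉B fx l with proj₁ (Join.homogeneous J x x∉A x∉B) | B-in c₃-right
      ... | inj₁ complete     | _             = complete
      ... | inj₂ anticomplete | b , b∈B , _ = ⊥-elim (unreachable (close x b))
        where
        x-B : VAnticomplete G x B
        x-B = left-anticomplete-B x∉A x∉B fx l
        middle : ∀ w → Adj x w → ¬ Adj w b
        middle w xw wb with place A B w
        ... | inA w∈A = anticomplete w w∈A xw
        ... | inB w∈B = x-B w w∈B xw
        ... | outside w∉A w∉B with side (f w)
        ...   | inj₁ lw = left-anticomplete-B w∉A w∉B refl lw b b∈B wb
        ...   | inj₂ rw = no-crossing x∉A w∉B fx refl l rw xw
        unreachable : ¬ Dist≤2 G x b
        unreachable (inj₁ refl)                 = x∉B b∈B
        unreachable (inj₂ (inj₁ xb))            = x-B b b∈B xb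
        unreachable (inj₂ (inj₂ (w , xw , wb))) = middle w xw wb

      -- the left classes form a clique: two non-adjacent outside vertices
      -- there would form a claw with a vertex a ∈ A and a neighbour of a in B
      left-clique : ∀ {u v c d} → u ≢ v → f u ≡ c → f v ≡ d → Left c → Left d → Adj u v
      left-clique {u} {v} u≢v fu fv lu lv with place A B u | place A B v
      ... | inB u∈B | _ = ⊥-elim (B-not-left u∈B fu lu)
      ... | _ | inB v∈B = ⊥-elim (B-not-left v∈B fv lv)
      ... | inA u∈A | inA v∈A = cliqueA u v u∈A v∈A u≢v
      ... | inA u∈A | outside v∉A v∉B = adj-sym (left-complete-A v∉A v∉B fv lv u u∈A)
      ... | outside u∉A u∉B | inA v∈A = left-complete-A u∉A u∉B fu lu v v∈A
      ... | outside u∉A u∉B | outside v∉A v∉B with adj? u v | A-in c₁-left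
      ...   | yes uv | _ = uv
      ...   | no ¬uv | a , a∈A , _ with neighbourA a a∈A
      ...     | b , b∈B , ab =
        ⊥-elim (claw-free a b u v (λ { refl → u∉B b∈B }) u≢v (λ { refl → v∉B b∈B })
          ab (adj-sym (left-complete-A u∉A u∉B fu lu a a∈A))
          (adj-sym (left-complete-A v∉A v∉B fv lv a a∈A))
          (λ bu → left-anticomplete-B u∉A u∉B fu lu b b∈B (adj-sym bu)) ¬uv
          (λ bv → left-anticomplete-B v∉A v∉B fv lv b b∈B (adj-sym bv)))

  reflect-tight : ∀ {A B f} → Tight A B f → Tight B A (act reflect ∘ f)
  reflect-tight (t₁ , t₂) = reflect-pair (⊎-swap t₁) , reflect-pair (⊎-swap t₂)
    where
    reflect-pair : ∀ {S R f c d} → Covers S f c ⊎ Covers R f d →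
      Covers S (act reflect ∘ f) (act reflect c) ⊎ Covers R (act reflect ∘ f) (act reflect d)
    reflect-pair (inj₁ k) = inj₁ (covers-relabel reflect k)
    reflect-pair (inj₂ k) = inj₂ (covers-relabel reflect k)

  module _ (claw-free : ClawFree G) (close : ∀ u v → Dist≤2 G u v) where
    open Join using (cliqueA; cliqueB)

    -- in the tight case the left and the right classes are cliques, so the
    -- colouring by side shows that G is cobipartite
    tight-cobipartite : ∀ {A B f} → Join A B → Separated f → Straddle A B f → Tight A B f →
      Cobipartite G
    tight-cobipartite {f = f} J sep S T = (isLeft ∘ f) , same-colour-adjacent
      where
      right-clique : ∀ {u v c d} → u ≢ v → f u ≡ c → f v ≡ d → Right c → Right d → Adj u v
      right-clique u≢v fu fv ru rv =
        Straddled.left-clique (swapJoin J) (relabel reflect sep) (reflect-straddle S) claw-free close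
          (reflect-tight T) u≢v (cong (act reflect) fu) (cong (act reflect) fv)
          (reflect-right ru) (reflect-right rv)
      same-colour-adjacent : ∀ u v → u ≢ v → isLeft (f u) ≡ isLeft (f v) → Adj u v
      same-colour-adjacent u v u≢v same with side (f u) | side (f v)
      ... | inj₁ lu | inj₁ lv = Straddled.left-clique J sep S claw-free close T u≢v refl refl lu lv
      ... | inj₂ ru | inj₂ rv = right-clique u≢v refl refl ru rv
      ... | inj₁ lu | inj₂ rv = ⊥-elim (sides-differ lu rv same)
      ... | inj₂ ru | inj₁ lv = ⊥-elim (sides-differ lv ru (sym same))

    straddle-avoiding : ∀ {A B f} → Join A B → ¬ Cobipartite G → Separated f → Straddle A B f →
      AvoidingLabelling A B
    straddle-avoiding {A} {B} {f} J ¬cobipartite sep S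
      with escapes-or-covers A B f c₁ c₄ | escapes-or-covers A B f c₂ c₃
    ... | inj₁ (e₁ , e₄) | _ = Straddled.relocate J sep S e₁ e₄
    ... | inj₂ _ | inj₁ (e₂ , e₃) =
      Straddled.relocate J (relabel flip sep) (flip-straddle S)
        (escapes-relabel flip e₂) (escapes-relabel flip e₃)
    ... | inj₂ t₁ | inj₂ t₂ = ⊥-elim (¬cobipartite (tight-cobipartite J sep S (t₁ , t₂)))

    -- If every class meets A ∪ B then, A and B being cliques, A meets two
    -- consecutive classes and B the other two; a symmetry makes it straddle.
    straddle-up-to-symmetry : ∀ {A B f} → Join A B → Separated f →
      Meets A f c₁ ⊎ Meets B f c₁ → Meets A f c₂ ⊎ Meets B f c₂ →
      Meets A f c₃ ⊎ Meets B f c₃ → Meets A f c₄ ⊎ Meets B f c₄ →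
      ∃[ g ] (Separated g × Straddle A B g)
    straddle-up-to-symmetry {f = f} J sep (inj₁ M₁) (inj₁ M₂) (inj₂ M₃) (inj₂ M₄) =
      f , sep , (M₁ , M₂ , M₃ , M₄)
    straddle-up-to-symmetry J sep (inj₂ M₁) (inj₁ M₂) (inj₁ M₃) (inj₂ M₄) =
      _ , relabel rotate sep ,
      (meets-relabel rotate M₂ , meets-relabel rotate M₃ ,
       meets-relabel rotate M₄ , meets-relabel rotate M₁)
    straddle-up-to-symmetry J sep (inj₂ M₁) (inj₂ M₂) (inj₁ M₃) (inj₁ M₄) =
      _ , relabel reflect sep , reflect-straddle (M₁ , M₂ , M₃ , M₄)
    straddle-up-to-symmetry {f = f} J sep (inj₁ M₁) (inj₂ M₂) (inj₂ M₃) (inj₁ M₄) =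
      _ , relabel reflect (relabel rotate sep) , (turn M₁ , turn M₄ , turn M₃ , turn M₂)
      where
      turn : ∀ {S c} → Meets S f c →
        Meets S (act reflect ∘ act rotate ∘ f) (act reflect (act rotate c))
      turn = meets-relabel reflect ∘ meets-relabel rotate
    straddle-up-to-symmetry J sep (inj₁ M₁) _ (inj₁ M₃) _ =
      ⊥-elim (clique-opposite (cliqueA J) sep M₁ M₃)
    straddle-up-to-symmetry J sep (inj₂ M₁) _ (inj₂ M₃) _ =
      ⊥-elim (clique-opposite (cliqueB J) sep M₁ M₃)
    straddle-up-to-symmetry J sep _ (inj₁ M₂) _ (inj₁ M₄) =
      ⊥-elim (clique-opposite (cliqueA J) sep M₂ M₄)
    straddle-up-to-symmetry J sep _ (inj₂ M₂) _ (inj₂ M₄) =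
      ⊥-elim (clique-opposite (cliqueB J) sep M₂ M₄)

    avoiding-labelling : ∀ {A B f} → Join A B → ¬ Cobipartite G → DisconnectedLabelling f →
      AvoidingLabelling A B
    avoiding-labelling {A} {B} {f} J ¬cobipartite L
      with avoids-or-meets A B f c₁ | avoids-or-meets A B f c₂
         | avoids-or-meets A B f c₃ | avoids-or-meets A B f c₄
    ... | inj₁ av | _ | _ | _ = f , L , c₁ , av
    ... | _ | inj₁ av | _ | _ = f , L , c₂ , av
    ... | _ | _ | inj₁ av | _ = f , L , c₃ , av
    ... | _ | _ | _ | inj₁ av = f , L , c₄ , av
    ... | inj₂ m₁ | inj₂ m₂ | inj₂ m₃ | inj₂ m₄
      with straddle-up-to-symmetry J (DisconnectedLabelling.separated L) m₁ m₂ m₃ m₄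
    ...   | g , sep , S = straddle-avoiding J ¬cobipartite sep S

lemma14 : (G : Graph) → ClawFree G → ¬ Cobipartite G → DistinctNbhds G →
    Diameter2 G → (A B : Subset (Graph.n G)) → Unshatterable G A B →
    (∃[ U ] DisconnectedCut G U) →
    ∃[ V₁ ] ∃[ V₂ ] ∃[ V₃ ] ∃[ V₄ ] (DisconnectedPartition G V₁ V₂ V₃ V₄ ×
      (AvoidsBoth G V₁ A B ⊎ AvoidsBoth G V₂ A B ⊎
       AvoidsBoth G V₃ A B ⊎ AvoidsBoth G V₄ A B))
lemma14 G claw-free ¬cobipartite _ (close , _) A B (proper , _) (_ , cut) =
  conclusion G (avoiding-labelling G claw-free close (properJoin G proper) ¬cobipartite
    (proj₂ (cutLabelling G cut)))
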